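{- Let $R,S,T:X\leftrightarrow\mathcal{P}Y$ be multirelations. Then (1) if $R\subseteq S$ then $R\cap T\sqsubseteq_\downarrow S\cap T$ and $S\cap T\sqsubseteq_\uparrow R\cap T$; (2) $R\Cap S\sqsubseteq_\downarrow R\sqsubseteq_\downarrow R\Cup R$, $R\Cap R\sqsubseteq_\uparrow R\sqsubseteq_\uparrow R\Cup S$ and $R\Cap R\sqsubseteq_\updownarrow R\sqsubseteq_\updownarrow R\Cup R$; (3) $R\Cap S\sqsubseteq_\downarrow R\Cup S$, $R\Cap S\sqsubseteq_\uparrow R\Cup S$ and $R\Cap S\sqsubseteq_\updownarrow R\Cup S$; (4) with respect to the preorder $\sqsubseteq_\downarrow$, $R\Cap S$ is a greatest lower bound and $R\cup S$ a least upper bound of $R$ and $S$ (unique up to $=_\downarrow$); (5) with respect to the preorder $\sqsubseteq_\uparrow$, $R\Cup S$ is a least upper bound and $R\cup S$ a greatest lower bound of $R$ and $S$ (unique up to $=_\uparrow$).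
   Context: A multirelation is a relation $R\subseteq X\times\mathcal{P}Y$. Inner union $R\Cup S=\{(a,A\cup B)\mid (a,A)\in R\wedge (a,B)\in S\}$, inner intersection $R\Cap S=\{(a,A\cap B)\mid (a,A)\in R\wedge (a,B)\in S\}$. Inner closures: $\uparrow R=\{(a,A)\mid\exists B.\,(a,B)\in R\wedge B\subseteq A\}$, $\downarrow R=\{(a,A)\mid\exists B.\,(a,B)\in R\wedge A\subseteq B\}$. Preorders: $R\sqsubseteq_\uparrow S\Leftrightarrow S\subseteq\uparrow R$; $R\sqsubseteq_\downarrow S\Leftrightarrow R\subseteq\downarrow S$; $R\sqsubseteq_\updownarrow S\Leftrightarrow R\sqsubseteq_\downarrow S\wedge R\sqsubseteq_\uparrow S$. Equivalences: $R=_\downarrow S\Leftrightarrow\downarrow R=\downarrow S$, $R=_\uparrow S\Leftrightarrow\uparrow R=\uparrow S$. -}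

module Defs where

open import Level using (0ℓ)
open import Data.Product using (Σ; ∃; _×_; _,_)
open import Data.Sum using (_⊎_)
open import Relation.Unary using (Pred; _⊆_; _∪_; _∩_; _≐_)

-- Subsets of Y are predicates Pred Y 0ℓ; a multirelation X ↔ 𝒫Y is a
-- (proof-relevant) relation between X and 𝒫Y.
MRel : Set → Set → Set₂
MRel X Y = X → Pred Y 0ℓ → Set₁


module _ {X Y : Set} where

  _⊆ᴹ_ : MRel X Y → MRel X Y → Set₁
  R ⊆ᴹ S = ∀ a A → R a A → S a A

  _∪ᴹ_ : MRel X Y → MRel X Y → MRel X Y
  (R ∪ᴹ S) a A = R a A ⊎ S a A

  _∩ᴹ_ : MRel X Y → MRel X Y → MRel X Y
  (R ∩ᴹ S) a A = R a A × S a A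

  _⋓_ : MRel X Y → MRel X Y → MRel X Y
  (R ⋓ S) a C = Σ (Pred Y 0ℓ) λ A → Σ (Pred Y 0ℓ) λ B → R a A × S a B × C ≐ (A ∪ B)

  _⋒_ : MRel X Y → MRel X Y → MRel X Y
  (R ⋒ S) a C = Σ (Pred Y 0ℓ) λ A → Σ (Pred Y 0ℓ) λ B → R a A × S a B × C ≐ (A ∩ B)

  ↑ : MRel X Y → MRel X Y
  ↑ R a A = Σ (Pred Y 0ℓ) λ B → R a B × B ⊆ A

  ↓ : MRel X Y → MRel X Y
  ↓ R a A = Σ (Pred Y 0ℓ) λ B → R a B × A ⊆ B

  _⊑↑_ : MRel X Y → MRel X Y → Set₁
  R ⊑↑ S = S ⊆ᴹ ↑ R

  _⊑↓_ : MRel X Y → MRel X Y → Set₁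
  R ⊑↓ S = R ⊆ᴹ ↓ S

  _⊑↕_ : MRel X Y → MRel X Y → Set₁
  R ⊑↕ S = (R ⊑↓ S) × (R ⊑↑ S)

  _=↓_ : MRel X Y → MRel X Y → Set₁
  R =↓ S = (↓ R ⊆ᴹ ↓ S) × (↓ S ⊆ᴹ ↓ R)

  _=↑_ : MRel X Y → MRel X Y → Set₁
  R =↑ S = (↑ R ⊆ᴹ ↑ S) × (↑ S ⊆ᴹ ↑ R)

  IsGLB : (MRel X Y → MRel X Y → Set₁) → MRel X Y → MRel X Y → MRel X Y → Set₂
  IsGLB _⊑_ R S G = (G ⊑ R) × (G ⊑ S) × (∀ T → T ⊑ R → T ⊑ S → T ⊑ G)

  IsLUB : (MRel X Y → MRel X Y → Set₁) → MRel X Y → MRel X Y → MRel X Y → Set₂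
  IsLUB _⊑_ R S L = (R ⊑ L) × (S ⊑ L) × (∀ T → R ⊑ T → S ⊑ T → L ⊑ T)

-- R ⊑↓ S says exactly that ↓R ⊆ ↓S, and R ⊑↑ S that ↑S ⊆ ↑R. Down-closed sets
-- are closed under intersection and up-closed ones under union, so witnesses
-- A ⊇ C and B ⊇ C from R and S give A ∩ B ⊇ C in R ⋒ S (dually A ∪ B for ⋓):
-- inner intersection is the ⊑↓-meet and inner union the ⊑↑-join, while plain
-- union is the join for ⊑↓ and the meet for ⊑↑. Bounds are unique up to the
-- induced equivalence because any two of them are ⊑-related both ways.
module Submission where

open import Level using (0ℓ)
open import Defs
open import Data.Product using (_×_; _,_; proj₁; proj₂)
open import Data.Sum using (inj₁; inj₂; [_,_])
open import Function using (id)
open import Relation.Unary using (Pred; _∪_; _∩_)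
open import Relation.Unary.Properties using (≐-refl)

module _ {X Y : Set} where

  private
    variable
      R S T M N : MRel X Y
      a : X
      A B : Pred Y 0ℓ

  ⋒-intro : ∀ R S → R a A → S a B → (R ⋒ S) a (A ∩ B)
  ⋒-intro R S rA sB = _ , _ , rA , sB , ≐-refl

  ⋓-intro : ∀ R S → R a A → S a B → (R ⋓ S) a (A ∪ B)
  ⋓-intro R S rA sB = _ , _ , rA , sB , ≐-refl

  ⋒-diagonal : R ⊆ᴹ (R ⋒ R)
  ⋒-diagonal a A rA = A , A , rA , rA , (λ x → x , x) , proj₁

  ⋓-diagonal : R ⊆ᴹ (R ⋓ R)
  ⋓-diagonal a A rA = A , A , rA , rA , inj₁ , [ id , id ]

  ∪ᴹ-upperˡ : R ⊆ᴹ (R ∪ᴹ S)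
  ∪ᴹ-upperˡ a A = inj₁

  ∪ᴹ-upperʳ : S ⊆ᴹ (R ∪ᴹ S)
  ∪ᴹ-upperʳ a A = inj₂

  ∩ᴹ-monoˡ : R ⊆ᴹ S → (R ∩ᴹ T) ⊆ᴹ (S ∩ᴹ T)
  ∩ᴹ-monoˡ R⊆S a A (rA , tA) = R⊆S a A rA , tA

  ⊆⇒⊑↓ : R ⊆ᴹ S → R ⊑↓ S
  ⊆⇒⊑↓ R⊆S a A rA = A , R⊆S a A rA , id

  ⊆⇒⊒↑ : R ⊆ᴹ S → S ⊑↑ R
  ⊆⇒⊒↑ R⊆S a A rA = A , R⊆S a A rA , id

  ⊑↓⇒↓⊆↓ : R ⊑↓ S → ↓ R ⊆ᴹ ↓ S
  ⊑↓⇒↓⊆↓ R⊑S a A (B , rB , A⊆B) with R⊑S a B rB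
  ... | C , sC , B⊆C = C , sC , λ x → B⊆C (A⊆B x)

  ⊑↑⇒↑⊇↑ : R ⊑↑ S → ↑ S ⊆ᴹ ↑ R
  ⊑↑⇒↑⊇↑ R⊑S a A (B , sB , B⊆A) with R⊑S a B sB
  ... | C , rC , C⊆B = C , rC , λ x → B⊆A (C⊆B x)

  ⊑↓-antisym : R ⊑↓ S → S ⊑↓ R → R =↓ S
  ⊑↓-antisym R⊑S S⊑R = ⊑↓⇒↓⊆↓ R⊑S , ⊑↓⇒↓⊆↓ S⊑R

  ⊑↑-antisym : R ⊑↑ S → S ⊑↑ R → R =↑ S
  ⊑↑-antisym R⊑S S⊑R = ⊑↑⇒↑⊇↑ S⊑R , ⊑↑⇒↑⊇↑ R⊑S

  ⋒-lowerˡ-⊑↓ : (R ⋒ S) ⊑↓ R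
  ⋒-lowerˡ-⊑↓ a C (A , B , rA , sB , C≐A∩B) = A , rA , λ x → proj₁ (proj₁ C≐A∩B x)

  ⋒-lowerʳ-⊑↓ : (R ⋒ S) ⊑↓ S
  ⋒-lowerʳ-⊑↓ a C (A , B , rA , sB , C≐A∩B) = B , sB , λ x → proj₂ (proj₁ C≐A∩B x)

  ↓-⋒-intro : ∀ R S → ↓ R a A → ↓ S a A → ↓ (R ⋒ S) a A
  ↓-⋒-intro R S (B , rB , A⊆B) (C , sC , A⊆C) = B ∩ C , ⋒-intro R S rB sC , λ x → A⊆B x , A⊆C x

  ⋒-greatest-⊑↓ : T ⊑↓ R → T ⊑↓ S → T ⊑↓ (R ⋒ S)
  ⋒-greatest-⊑↓ {R = R} {S = S} T⊑R T⊑S a A tA = ↓-⋒-intro R S (T⊑R a A tA) (T⊑S a A tA)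

  ⋓-upperˡ-⊑↑ : R ⊑↑ (R ⋓ S)
  ⋓-upperˡ-⊑↑ a C (A , B , rA , sB , C≐A∪B) = A , rA , λ x → proj₂ C≐A∪B (inj₁ x)

  ⋓-upperʳ-⊑↑ : S ⊑↑ (R ⋓ S)
  ⋓-upperʳ-⊑↑ a C (A , B , rA , sB , C≐A∪B) = B , sB , λ x → proj₂ C≐A∪B (inj₂ x)

  ↑-⋓-intro : ∀ R S → ↑ R a A → ↑ S a A → ↑ (R ⋓ S) a A
  ↑-⋓-intro R S (B , rB , B⊆A) (C , sC , C⊆A) = B ∪ C , ⋓-intro R S rB sC , [ B⊆A , C⊆A ]

  ⋓-least-⊑↑ : R ⊑↑ T → S ⊑↑ T → (R ⋓ S) ⊑↑ T
  ⋓-least-⊑↑ {R = R} {S = S} R⊑T S⊑T a A tA = ↑-⋓-intro R S (R⊑T a A tA) (S⊑T a A tA)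

  ∪ᴹ-least-⊑↓ : R ⊑↓ T → S ⊑↓ T → (R ∪ᴹ S) ⊑↓ T
  ∪ᴹ-least-⊑↓ R⊑T S⊑T a A = [ R⊑T a A , S⊑T a A ]

  ∪ᴹ-greatest-⊑↑ : T ⊑↑ R → T ⊑↑ S → T ⊑↑ (R ∪ᴹ S)
  ∪ᴹ-greatest-⊑↑ T⊑R T⊑S a A = [ T⊑R a A , T⊑S a A ]

  ⋒-⊑↓-⋓ : (R ⋒ S) ⊑↓ (R ⋓ S)
  ⋒-⊑↓-⋓ {R = R} {S = S} a C (A , B , rA , sB , C≐A∩B) =
    A ∪ B , ⋓-intro R S rA sB , λ x → inj₁ (proj₁ (proj₁ C≐A∩B x))

  ⋒-⊑↑-⋓ : (R ⋒ S) ⊑↑ (R ⋓ S)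
  ⋒-⊑↑-⋓ {R = R} {S = S} a C (A , B , rA , sB , C≐A∪B) =
    A ∩ B , ⋒-intro R S rA sB , λ x → proj₂ C≐A∪B (inj₁ (proj₁ x))

  ⋒-isGLB-⊑↓ : IsGLB _⊑↓_ R S (R ⋒ S)
  ⋒-isGLB-⊑↓ = ⋒-lowerˡ-⊑↓ , ⋒-lowerʳ-⊑↓ , λ _ → ⋒-greatest-⊑↓

  ∪ᴹ-isLUB-⊑↓ : IsLUB _⊑↓_ R S (R ∪ᴹ S)
  ∪ᴹ-isLUB-⊑↓ = ⊆⇒⊑↓ ∪ᴹ-upperˡ , ⊆⇒⊑↓ ∪ᴹ-upperʳ , λ _ → ∪ᴹ-least-⊑↓

  ⋓-isLUB-⊑↑ : IsLUB _⊑↑_ R S (R ⋓ S)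
  ⋓-isLUB-⊑↑ = ⋓-upperˡ-⊑↑ , ⋓-upperʳ-⊑↑ , λ _ → ⋓-least-⊑↑

  ∪ᴹ-isGLB-⊑↑ : IsGLB _⊑↑_ R S (R ∪ᴹ S)
  ∪ᴹ-isGLB-⊑↑ = ⊆⇒⊒↑ ∪ᴹ-upperˡ , ⊆⇒⊒↑ ∪ᴹ-upperʳ , λ _ → ∪ᴹ-greatest-⊑↑

  IsGLB⇒⊑ : (_⊑_ : MRel X Y → MRel X Y → Set₁) →
            IsGLB _⊑_ R S M → IsGLB _⊑_ R S N → M ⊑ N
  IsGLB⇒⊑ _ (M⊑R , M⊑S , _) (_ , _ , greatest) = greatest _ M⊑R M⊑S

  IsLUB⇒⊑ : (_⊑_ : MRel X Y → MRel X Y → Set₁) →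
            IsLUB _⊑_ R S M → IsLUB _⊑_ R S N → M ⊑ N
  IsLUB⇒⊑ _ (_ , _ , least) (R⊑N , S⊑N , _) = least _ R⊑N S⊑N

lemma5p7 : {X Y : Set} (R S T : MRel X Y) →
    -- (1)
    ((R ⊆ᴹ S) → ((R ∩ᴹ T) ⊑↓ (S ∩ᴹ T)) × ((S ∩ᴹ T) ⊑↑ (R ∩ᴹ T)))
    -- (2)
    × (((R ⋒ S) ⊑↓ R) × (R ⊑↓ (R ⋓ R)))
    × (((R ⋒ R) ⊑↑ R) × (R ⊑↑ (R ⋓ S)))
    × (((R ⋒ R) ⊑↕ R) × (R ⊑↕ (R ⋓ R)))
    -- (3)
    × ((R ⋒ S) ⊑↓ (R ⋓ S)) × ((R ⋒ S) ⊑↑ (R ⋓ S)) × ((R ⋒ S) ⊑↕ (R ⋓ S))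
    -- (4)
    × IsGLB _⊑↓_ R S (R ⋒ S)
    × (∀ G → IsGLB _⊑↓_ R S G → G =↓ (R ⋒ S))
    × IsLUB _⊑↓_ R S (R ∪ᴹ S)
    × (∀ L → IsLUB _⊑↓_ R S L → L =↓ (R ∪ᴹ S))
    -- (5)
    × IsLUB _⊑↑_ R S (R ⋓ S)
    × (∀ L → IsLUB _⊑↑_ R S L → L =↑ (R ⋓ S))
    × IsGLB _⊑↑_ R S (R ∪ᴹ S)
    × (∀ G → IsGLB _⊑↑_ R S G → G =↑ (R ∪ᴹ S))
lemma5p7 R S T =
    (λ R⊆S → ⊆⇒⊑↓ (∩ᴹ-monoˡ R⊆S) , ⊆⇒⊒↑ (∩ᴹ-monoˡ R⊆S))
  , (⋒-lowerˡ-⊑↓ , ⊆⇒⊑↓ ⋓-diagonal)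
  , (⊆⇒⊒↑ ⋒-diagonal , ⋓-upperˡ-⊑↑)
  , ((⋒-lowerˡ-⊑↓ , ⊆⇒⊒↑ ⋒-diagonal) , (⊆⇒⊑↓ ⋓-diagonal , ⋓-upperˡ-⊑↑))
  , ⋒-⊑↓-⋓ , ⋒-⊑↑-⋓ , (⋒-⊑↓-⋓ , ⋒-⊑↑-⋓)
  , ⋒-isGLB-⊑↓
  , (λ G isGLB → ⊑↓-antisym (IsGLB⇒⊑ _⊑↓_ isGLB ⋒-isGLB-⊑↓) (IsGLB⇒⊑ _⊑↓_ ⋒-isGLB-⊑↓ isGLB))
  , ∪ᴹ-isLUB-⊑↓
  , (λ L isLUB → ⊑↓-antisym (IsLUB⇒⊑ _⊑↓_ isLUB ∪ᴹ-isLUB-⊑↓) (IsLUB⇒⊑ _⊑↓_ ∪ᴹ-isLUB-⊑↓ isLUB))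
  , ⋓-isLUB-⊑↑
  , (λ L isLUB → ⊑↑-antisym (IsLUB⇒⊑ _⊑↑_ isLUB ⋓-isLUB-⊑↑) (IsLUB⇒⊑ _⊑↑_ ⋓-isLUB-⊑↑ isLUB))
  , ∪ᴹ-isGLB-⊑↑
  , (λ G isGLB → ⊑↑-antisym (IsGLB⇒⊑ _⊑↑_ isGLB ∪ᴹ-isGLB-⊑↑) (IsGLB⇒⊑ _⊑↑_ ∪ᴹ-isGLB-⊑↑ isGLB))
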